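{- Let $c$ be an even positive integer and $n\ge1$. Then $$\sum_{\pi \in G_{c,n}} (-1)^{\widetilde{inv}(\pi)} q^{fmaj(\pi)}=\sum_{\pi \in G_{c,n}} (-1)^{fmaj(\pi)} q^{\widetilde{inv}(\pi)}=\prod_{i=1}^n [ci]_{ -q}.$$
   Context: For positive integers $c,n$, $G_{c,n}$ is the set of colored permutations $\pi=\pi_1^{[t_1]}\cdots\pi_n^{[t_n]}$ with $|\pi|=\pi_1\cdots\pi_n$ a permutation of $[n]$ and colors $t_i\in\{0,\dots,c-1\}$; $col(\pi)=\sum_i t_i$; $inv(\sigma)$ is the number of pairs $i<j$ with $\sigma_i>\sigma_j$. Define $\widetilde{inv}(\pi)=c\cdot inv(|\pi|)+col(\pi)$. Order colored letters by $1^{[c-1]}<\cdots<n^{[c-1]}<\cdots<1^{[1]}<\cdots<n^{[1]}<1<\cdots<n$ (color $0$ without superscript); $Des_c(\pi)=\{i\in[n-1]:\pi_i^{[t_i]}>\pi_{i+1}^{[t_{i+1}]}\}$ in this order, $maj(\pi)=\sum_{i\in Des_c(\pi)}i$, and $fmaj(\pi)=c\cdot maj(\pi)+col(\pi)$. For a positive integer $m$, $[m]_x=1+x+\cdots+x^{m-1}$. -}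

module Defs where

open import Data.Nat using (ℕ; zero; suc; _+_; _*_; _∸_; _<ᵇ_; _≡ᵇ_; _%_)
open import Data.Bool using (Bool; true; false; if_then_else_; _∧_; _∨_)
open import Data.Integer as ℤ using (ℤ; +_; -_)
open import Data.List using (List; []; _∷_; map; concatMap; upTo; foldr; length)
open import Data.Nat.ListAction using (sum)
open import Data.Product using (_×_; _,_; proj₁; proj₂)
open import Relation.Binary.PropositionalEquality using (_≡_)

-- Polynomials in q with integer coefficients: coefficient lists,
-- constant term first.  Equality of polynomials = equality of all
-- coefficients.

Poly : Set
Poly = List ℤ

_+P_ : Poly → Poly → Poly
[] +P q = q
(a ∷ p) +P [] = a ∷ p
(a ∷ p) +P (b ∷ q) = (a ℤ.+ b) ∷ (p +P q)

scale : ℤ → Poly → Poly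
scale a = map (a ℤ.*_)

_*P_ : Poly → Poly → Poly
[] *P q = []
(a ∷ p) *P q = scale a q +P ((+ 0) ∷ (p *P q))

oneP : Poly
oneP = + 1 ∷ []

coeff : Poly → ℕ → ℤ
coeff [] k = + 0
coeff (a ∷ p) zero = a
coeff (a ∷ p) (suc k) = coeff p k

_≈P_ : Poly → Poly → Set
p ≈P r = ∀ k → coeff p k ≡ coeff r k

sgn : ℕ → ℤ
sgn k = if k % 2 ≡ᵇ 0 then + 1 else - (+ 1)

mono : ℤ → ℕ → Poly
mono a zero = a ∷ []
mono a (suc k) = + 0 ∷ mono a k

sumP : List Poly → Poly
sumP = foldr _+P_ []

prodP : List Poly → Poly
prodP = foldr _*P_ oneP

qIntNeg : ℕ → Poly
qIntNeg m = sumP (map (λ j → mono (sgn j) j) (upTo m))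

rhsProd : ℕ → ℕ → Poly
rhsProd c n = prodP (map (λ i → qIntNeg (c * suc i)) (upTo n))

-- Colored permutations.  A colored permutation π ∈ G_{c,n} is the list
-- of colored letters (π_i , t_i), i = 1..n.

Letter : Set
Letter = ℕ × ℕ   -- (value, color)

insertions : {A : Set} → A → List A → List (List A)
insertions x [] = (x ∷ []) ∷ []
insertions x (y ∷ ys) = (x ∷ y ∷ ys) ∷ map (y ∷_) (insertions x ys)

perms : ℕ → List (List ℕ)
perms zero = [] ∷ []
perms (suc n) = concatMap (insertions (suc n)) (perms n)

colorWords : ℕ → ℕ → List (List ℕ)
colorWords c zero = [] ∷ []
colorWords c (suc n) = concatMap (λ t → map (t ∷_) (colorWords c n)) (upTo c)

zipL : List ℕ → List ℕ → List Letter
zipL [] _ = []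
zipL (_ ∷ _) [] = []
zipL (a ∷ as) (t ∷ ts) = (a , t) ∷ zipL as ts

-- the set G_{c,n}, enumerated (each element exactly once)
G : ℕ → ℕ → List (List Letter)
G c n = concatMap (λ σ → map (zipL σ) (colorWords c n)) (perms n)

abs : List Letter → List ℕ
abs = map proj₁

col : List Letter → ℕ
col π = sum (map proj₂ π)

inv : List ℕ → ℕ
inv [] = 0
inv (x ∷ xs) = length (Data.List.filterᵇ (λ y → y <ᵇ x) xs) + inv xs

invT : ℕ → List Letter → ℕ
invT c π = c * inv (abs π) + col π

-- The order 1^{[c-1]} < … < n^{[c-1]} < … < 1^{[1]} < … < n^{[1]} < 1 < … < n:
-- colour t has rank (c-1) ∸ t  (so colour c-1 ↦ 0, …, colour 1 ↦ c-2,
-- colour 0 ↦ c-1); letters compare by (rank, value) lexicographically.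
rank : ℕ → ℕ → ℕ
rank c t = (c ∸ 1) ∸ t

gtL : ℕ → Letter → Letter → Bool
gtL c (a , s) (b , t) =
  (rank c t <ᵇ rank c s) ∨ ((rank c s ≡ᵇ rank c t) ∧ (b <ᵇ a))

-- maj(π) = sum of i ∈ Des_c(π); i is the position (1-based) of the
-- first letter of the current pair
majFrom : ℕ → ℕ → List Letter → ℕ
majFrom c i [] = 0
majFrom c i (x ∷ []) = 0
majFrom c i (x ∷ y ∷ ys) =
  (if gtL c x y then i else 0) + majFrom c (suc i) (y ∷ ys)

maj : ℕ → List Letter → ℕ
maj c π = majFrom c 1 π

fmaj : ℕ → List Letter → ℕ
fmaj c π = c * maj c π + col π

signedSum : ℕ → ℕ → (List Letter → ℕ) → (List Letter → ℕ) → Poly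
signedSum c n f g = sumP (map (λ π → mono (sgn (f π)) (g π)) (G c n))

module Submission where

-- Since c is even, (-1)^{c·a + col π} = (-1)^{col π}; hence both inv~ and fmaj have the sign
-- (-1)^{col π}, and each of the three expressions is Σ (-q)^e over a multiset of exponents e:
-- the values of fmaj, the values of inv~ on G_{c,n}, and the multiset {e₁ + ⋯ + eₙ : eᵢ < c i}
-- read off from the product. So it suffices that fmaj and inv~ both take the values
-- e₁ + ⋯ + eₙ, with multiplicity. This goes by induction on n: every element of G_{c,n+1} arises
-- exactly once by inserting the letter n+1, in one of the c colours t, into some π ∈ G_{c,n}.
-- Over the n+1 insertion positions inv increases by 0, …, n and, by the insertion lemma for the
-- major index, so does maj; the colour adds t to col. Hence the statistic increases by c·d + t
-- for d ≤ n and t < c, that is by each of 0, …, c(n+1) - 1 exactly once.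

open import Defs
open import Algebra.Structures using (IsCommutativeMonoid)
open import Data.Bool using (Bool; true; false; T; not; if_then_else_; _∧_)
open import Data.Bool.Properties using (T-∨; T-∧; ¬-not)
open import Data.Empty using (⊥-elim)
open import Data.Integer as ℤ using (ℤ; -_)
import Data.Integer.Properties as ℤ
open import Data.Integer.Tactic.RingSolver as ℤ-Solver using ()
open import Data.List
  using ( List; []; _∷_; _++_; _∷ʳ_; [_]; map; foldr; concat; concatMap; filterᵇ; length
        ; iterate; upTo; applyUpTo; downFrom; reverse)
open import Data.List.Effectful using (module MonadProperties)
open import Data.List.Properties
  using ( map-++; map-∘; map-id; map-cong; map-cong-local; map-concatMap; concatMap-map; concatMap-cong; concatMap-++
        ; ++-assoc; ++-identityʳ; length-++; length-map; filter-all; filter-reject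
        ; upTo-∷ʳ; map-upTo; reverse-upTo; length-applyUpTo; applyUpTo-∷ʳ)
open import Data.List.Relation.Unary.All as All using (All; []; _∷_)
import Data.List.Relation.Unary.All.Properties as All
open import Data.List.Relation.Binary.Permutation.Propositional as ↭
  using (_↭_; prep; swap; ↭-refl; ↭-sym; ↭-trans; ↭-reflexive; ↭⇒↭ₛ′; module PermutationReasoning)
open import Data.List.Relation.Binary.Permutation.Propositional.Properties
  using (map⁺; ++⁺; ++⁺ˡ; ++⁺ʳ; shifts; shift; ∷↭∷ʳ; drop-∷; ↭-length; ↭-reverse; All-resp-↭)
import Data.List.Relation.Binary.Permutation.Setoid.Properties as PermutationSetoid
open import Data.List.Reverse using (Reverse; []; _∶_∶ʳ_; reverseView)
open import Data.Nat as ℕ using (ℕ; zero; suc; _+_; _*_; _%_; _<_; _≤_; _<ᵇ_; _≡ᵇ_; s<s)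
import Data.Nat.Properties as ℕ
open import Data.Nat.DivMod using ([m+kn]%n≡m%n)
open import Data.Nat.Divisibility using (_∣_; divides)
open import Data.Nat.ListAction.Properties using (sum-↭)
open import Data.Nat.Tactic.RingSolver as ℕ-Solver using ()
open import Data.Product using (_×_; _,_; proj₁; proj₂)
open import Data.Product.Relation.Binary.Lex.Strict using (×-strictTotalOrder)
import Data.Sum as Sum
open import Function using (Equivalence; _∘_; flip)
open import Level using (0ℓ)
open import Relation.Binary using (StrictTotalOrder; tri<; tri≈; tri>)
open import Relation.Binary.Bundles using (Setoid)
open import Relation.Binary.Structures using (IsEquivalence)
open import Relation.Binary.PropositionalEquality
  using (_≡_; _≢_; refl; sym; trans; subst; subst₂; cong; cong₂; module ≡-Reasoning)
import Relation.Binary.Reasoning.Setoid as SetoidReasoning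
open import Relation.Nullary using (¬_)
open import Relation.Nullary.Decidable using (T?)

private variable
  A B C : Set

concatMap-↭ : ∀ (f : A → List B) {xs ys} → xs ↭ ys → concatMap f xs ↭ concatMap f ys
concatMap-↭ f ↭.refl        = ↭-refl
concatMap-↭ f (prep x p)    = ++⁺ˡ (f x) (concatMap-↭ f p)
concatMap-↭ f (swap x y p)  = ↭-trans (shifts (f x) (f y)) (++⁺ˡ (f y) (++⁺ˡ (f x) (concatMap-↭ f p)))
concatMap-↭ f (↭.trans p q) = ↭-trans (concatMap-↭ f p) (concatMap-↭ f q)

concatMap-cong-↭ : ∀ {f g : A → List B} xs → All (λ x → f x ↭ g x) xs → concatMap f xs ↭ concatMap g xs
concatMap-cong-↭ []       []           = ↭-refl
concatMap-cong-↭ (x ∷ xs) (fx↭gx ∷ ps) = ++⁺ fx↭gx (concatMap-cong-↭ xs ps)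

concatMap-++-↭ : ∀ (f g : A → List B) xs → concatMap (λ x → f x ++ g x) xs ↭ concatMap f xs ++ concatMap g xs
concatMap-++-↭ f g []       = ↭-refl
concatMap-++-↭ f g (x ∷ xs) = begin
  (f x ++ g x) ++ concatMap (λ x → f x ++ g x) xs  ≡⟨ ++-assoc (f x) (g x) _ ⟩
  f x ++ g x ++ concatMap (λ x → f x ++ g x) xs    ↭⟨ ++⁺ˡ (f x) (++⁺ˡ (g x) (concatMap-++-↭ f g xs)) ⟩
  f x ++ g x ++ concatMap f xs ++ concatMap g xs   ↭⟨ ++⁺ˡ (f x) (shifts (g x) (concatMap f xs)) ⟩
  f x ++ concatMap f xs ++ g x ++ concatMap g xs   ≡⟨ ++-assoc (f x) (concatMap f xs) _ ⟨
  (f x ++ concatMap f xs) ++ g x ++ concatMap g xs ∎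
  where open PermutationReasoning

concatMap-comm : ∀ (g : A → B → List C) xs ys →
  concatMap (λ x → concatMap (g x) ys) xs ↭ concatMap (λ y → concatMap (λ x → g x y) xs) ys
concatMap-comm g []       ys = ↭-reflexive (sym (concatMap-[] ys))
  where
  concatMap-[] : ∀ (ys : List B) → concatMap (λ _ → []) ys ≡ ([] {A = C})
  concatMap-[] []       = refl
  concatMap-[] (y ∷ ys) = concatMap-[] ys
concatMap-comm g (x ∷ xs) ys = ↭-trans
  (++⁺ˡ (concatMap (g x) ys) (concatMap-comm g xs ys))
  (↭-sym (concatMap-++-↭ (g x) (λ y → concatMap (λ x → g x y) xs) ys))

concatMap-[-] : ∀ (f : A → B) xs → concatMap (λ x → [ f x ]) xs ≡ map f xs
concatMap-[-] f []       = refl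
concatMap-[-] f (x ∷ xs) = cong (f x ∷_) (concatMap-[-] f xs)

concatMap-map-comm : ∀ (f : A → B → C) xs ys →
  concatMap (λ x → map (f x) ys) xs ↭ concatMap (λ y → map (flip f y) xs) ys
concatMap-map-comm f xs ys = begin
  concatMap (λ x → map (f x) ys) xs                         ≡⟨ concatMap-cong (λ x → concatMap-[-] (f x) ys) xs ⟨
  concatMap (λ x → concatMap (λ y → [ f x y ]) ys) xs       ↭⟨ concatMap-comm (λ x y → [ f x y ]) xs ys ⟩
  concatMap (λ y → concatMap (λ x → [ f x y ]) xs) ys       ≡⟨ concatMap-cong (λ y → concatMap-[-] (flip f y) xs) ys ⟩
  concatMap (λ y → map (flip f y) xs) ys                    ∎
  where open PermutationReasoning

concatMap-concatMap : ∀ (g : B → List C) (f : A → List B) xs → concatMap g (concatMap f xs) ≡ concatMap (concatMap g ∘ f) xs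
concatMap-concatMap g f xs = sym (MonadProperties.associative xs f g)

All-concatMap⁺ : ∀ {P : B → Set} {f : A → List B} {xs} → All (All P ∘ f) xs → All P (concatMap f xs)
All-concatMap⁺ = All.concat⁺ ∘ All.map⁺

length-∷ʳ : ∀ (xs : List A) x → length (xs ∷ʳ x) ≡ suc (length xs)
length-∷ʳ xs x = trans (length-++ xs) (ℕ.+-comm (length xs) 1)

insertions-↭ : ∀ (x : A) xs → All (_↭ x ∷ xs) (insertions x xs)
insertions-↭ x []       = ↭-refl ∷ []
insertions-↭ x (y ∷ xs) =
  ↭-refl ∷ All.map⁺ (All.map (λ ι↭x∷xs → ↭-trans (prep y ι↭x∷xs) (swap y x ↭-refl)) (insertions-↭ x xs))

insertions-∷ʳ : ∀ (x : A) xs y → insertions x (xs ∷ʳ y) ≡ map (_∷ʳ y) (insertions x xs) ∷ʳ (xs ∷ʳ y ∷ʳ x)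
insertions-∷ʳ x []       y = refl
insertions-∷ʳ x (z ∷ xs) y = cong ((x ∷ z ∷ xs ∷ʳ y) ∷_) (begin
  map (z ∷_) (insertions x (xs ∷ʳ y))
    ≡⟨ cong (map (z ∷_)) (insertions-∷ʳ x xs y) ⟩
  map (z ∷_) (map (_∷ʳ y) (insertions x xs) ∷ʳ (xs ∷ʳ y ∷ʳ x))
    ≡⟨ map-++ (z ∷_) (map (_∷ʳ y) (insertions x xs)) _ ⟩
  map (z ∷_) (map (_∷ʳ y) (insertions x xs)) ∷ʳ (z ∷ xs ∷ʳ y ∷ʳ x)
    ≡⟨ cong (_∷ʳ (z ∷ xs ∷ʳ y ∷ʳ x)) (map-∘ (insertions x xs)) ⟨
  map (λ ι → z ∷ ι ∷ʳ y) (insertions x xs) ∷ʳ (z ∷ xs ∷ʳ y ∷ʳ x)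
    ≡⟨ cong (_∷ʳ (z ∷ xs ∷ʳ y ∷ʳ x)) (map-∘ (insertions x xs)) ⟩
  map (_∷ʳ y) (map (z ∷_) (insertions x xs)) ∷ʳ (z ∷ xs ∷ʳ y ∷ʳ x) ∎)
  where open ≡-Reasoning

map-insertions : ∀ (f : A → B) x xs → map (map f) (insertions x xs) ≡ insertions (f x) (map f xs)
map-insertions f x []       = refl
map-insertions f x (y ∷ xs) = cong ((f x ∷ f y ∷ map f xs) ∷_) (begin
  map (map f) (map (y ∷_) (insertions x xs))    ≡⟨ map-∘ (insertions x xs) ⟨
  map (λ ι → f y ∷ map f ι) (insertions x xs)   ≡⟨ map-∘ (insertions x xs) ⟩
  map (f y ∷_) (map (map f) (insertions x xs))  ≡⟨ cong (map (f y ∷_)) (map-insertions f x xs) ⟩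
  map (f y ∷_) (insertions (f x) (map f xs))    ∎)
  where open ≡-Reasoning

filterᵇ-insertions : ∀ (p : A → Bool) {x} → ¬ T (p x) → ∀ xs →
  All (λ ι → filterᵇ p ι ≡ filterᵇ p xs) (insertions x xs)
filterᵇ-insertions p ¬px []       = filter-reject (T? ∘ p) ¬px ∷ []
filterᵇ-insertions p ¬px (y ∷ xs) =
  filter-reject (T? ∘ p) ¬px ∷ All.map⁺ (All.map filterᵇ-∷-cong (filterᵇ-insertions p ¬px xs))
  where
  filterᵇ-∷-cong : ∀ {ι} → filterᵇ p ι ≡ filterᵇ p xs → filterᵇ p (y ∷ ι) ≡ filterᵇ p (y ∷ xs)
  filterᵇ-∷-cong eq with p y
  ... | true  = cong (y ∷_) eq
  ... | false = eq

upTo-+ : ∀ m n → upTo (m + n) ≡ upTo m ++ map (m +_) (upTo n)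
upTo-+ m zero    = trans (cong upTo (ℕ.+-identityʳ m)) (sym (++-identityʳ (upTo m)))
upTo-+ m (suc n) = begin
  upTo (m + suc n)                                   ≡⟨ cong upTo (ℕ.+-suc m n) ⟩
  upTo (suc (m + n))                                 ≡⟨ upTo-∷ʳ (m + n) ⟨
  upTo (m + n) ∷ʳ (m + n)                            ≡⟨ cong (_∷ʳ (m + n)) (upTo-+ m n) ⟩
  (upTo m ++ map (m +_) (upTo n)) ∷ʳ (m + n)         ≡⟨ ++-assoc (upTo m) _ _ ⟩
  upTo m ++ map (m +_) (upTo n) ∷ʳ (m + n)           ≡⟨ cong (upTo m ++_) (map-++ (m +_) (upTo n) _) ⟨
  upTo m ++ map (m +_) (upTo n ∷ʳ n)                 ≡⟨ cong (λ l → upTo m ++ map (m +_) l) (upTo-∷ʳ n) ⟩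
  upTo m ++ map (m +_) (upTo (suc n))                ∎
  where open ≡-Reasoning

upTo-* : ∀ c k → concatMap (λ d → map (c * d +_) (upTo c)) (upTo k) ≡ upTo (c * k)
upTo-* c zero    = cong upTo (sym (ℕ.*-zeroʳ c))
upTo-* c (suc k) = begin
  concatMap blocks (upTo (suc k))                          ≡⟨ cong (concatMap blocks) (upTo-∷ʳ k) ⟨
  concatMap blocks (upTo k ∷ʳ k)                           ≡⟨ concatMap-++ blocks (upTo k) (k ∷ []) ⟩
  concatMap blocks (upTo k) ++ map (c * k +_) (upTo c) ++ [] ≡⟨ cong₂ _++_ (upTo-* c k) (++-identityʳ _) ⟩
  upTo (c * k) ++ map (c * k +_) (upTo c)                  ≡⟨ upTo-+ (c * k) c ⟨
  upTo (c * k + c)                                         ≡⟨ cong upTo (trans (ℕ.+-comm (c * k) c) (sym (ℕ.*-suc c k))) ⟩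
  upTo (c * suc k)                                         ∎
  where
  open ≡-Reasoning
  blocks : ℕ → List ℕ
  blocks d = map (c * d +_) (upTo c)

-- The equality _≈P_, wrapped in a record: as a function type it does not
-- determine the two polynomials, so Agda could not infer them from a proof.
infix 4 _≃_
record _≃_ (p r : Poly) : Set where
  constructor coeffwise
  field coeff-≡ : ∀ k → coeff p k ≡ coeff r k
open _≃_ public

≃-isEquivalence : IsEquivalence _≃_
≃-isEquivalence = record
  { refl  = coeffwise λ _ → refl
  ; sym   = λ p≃r → coeffwise λ k → sym (coeff-≡ p≃r k)
  ; trans = λ p≃r r≃s → coeffwise λ k → trans (coeff-≡ p≃r k) (coeff-≡ r≃s k)
  }

≃-setoid : Setoid 0ℓ 0ℓ
≃-setoid = record { isEquivalence = ≃-isEquivalence }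

open Setoid ≃-setoid public using () renaming (refl to ≃-refl; sym to ≃-sym; trans to ≃-trans; reflexive to ≃-reflexive)

coeff-+P : ∀ p r k → coeff (p +P r) k ≡ coeff p k ℤ.+ coeff r k
coeff-+P []      r       k       = sym (ℤ.+-identityˡ _)
coeff-+P (a ∷ p) []      zero    = sym (ℤ.+-identityʳ a)
coeff-+P (a ∷ p) []      (suc k) = sym (ℤ.+-identityʳ _)
coeff-+P (a ∷ p) (b ∷ r) zero    = refl
coeff-+P (a ∷ p) (b ∷ r) (suc k) = coeff-+P p r k

coeff-scale : ∀ a p k → coeff (scale a p) k ≡ a ℤ.* coeff p k
coeff-scale a []      k       = sym (ℤ.*-zeroʳ a)
coeff-scale a (b ∷ p) zero    = refl
coeff-scale a (b ∷ p) (suc k) = coeff-scale a p k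

+P-coeffwise : ∀ p r s t →
  (∀ k → coeff p k ℤ.+ coeff r k ≡ coeff s k ℤ.+ coeff t k) → p +P r ≃ s +P t
+P-coeffwise p r s t eq = coeffwise λ k → begin
  coeff (p +P r) k          ≡⟨ coeff-+P p r k ⟩
  coeff p k ℤ.+ coeff r k   ≡⟨ eq k ⟩
  coeff s k ℤ.+ coeff t k   ≡⟨ coeff-+P s t k ⟨
  coeff (s +P t) k          ∎
  where open ≡-Reasoning

+P-cong : ∀ {p p′ r r′} → p ≃ p′ → r ≃ r′ → p +P r ≃ p′ +P r′
+P-cong {p} {p′} {r} {r′} p≃p′ r≃r′ =
  +P-coeffwise p r p′ r′ λ k → cong₂ ℤ._+_ (coeff-≡ p≃p′ k) (coeff-≡ r≃r′ k)

+P-identityʳ : ∀ p → p +P [] ≃ p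
+P-identityʳ []      = ≃-refl
+P-identityʳ (a ∷ p) = ≃-refl

+P-comm : ∀ p r → p +P r ≃ r +P p
+P-comm p r = +P-coeffwise p r r p λ k → ℤ.+-comm (coeff p k) (coeff r k)

+P-assoc : ∀ p r s → (p +P r) +P s ≃ p +P (r +P s)
+P-assoc p r s = coeffwise λ k → begin
  coeff ((p +P r) +P s) k                  ≡⟨ coeff-+P (p +P r) s k ⟩
  coeff (p +P r) k ℤ.+ coeff s k           ≡⟨ cong (ℤ._+ coeff s k) (coeff-+P p r k) ⟩
  coeff p k ℤ.+ coeff r k ℤ.+ coeff s k    ≡⟨ ℤ.+-assoc (coeff p k) _ _ ⟩
  coeff p k ℤ.+ (coeff r k ℤ.+ coeff s k)  ≡⟨ cong (λ z → coeff p k ℤ.+ z) (coeff-+P r s k) ⟨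
  coeff p k ℤ.+ coeff (r +P s) k           ≡⟨ coeff-+P p (r +P s) k ⟨
  coeff (p +P (r +P s)) k                  ∎
  where open ≡-Reasoning

+P-isCommutativeMonoid : IsCommutativeMonoid _≃_ _+P_ []
+P-isCommutativeMonoid = record
  { isMonoid = record
    { isSemigroup = record
      { isMagma = record { isEquivalence = ≃-isEquivalence ; ∙-cong = +P-cong }
      ; assoc   = +P-assoc
      }
    ; identity = (λ _ → ≃-refl) , +P-identityʳ
    }
  ; comm = +P-comm
  }

sumP-↭ : ∀ {ps rs} → ps ↭ rs → sumP ps ≃ sumP rs
sumP-↭ ps↭rs = PermutationSetoid.foldr-commMonoid ≃-setoid +P-isCommutativeMonoid (↭⇒↭ₛ′ ≃-isEquivalence ps↭rs)

sumP-++ : ∀ ps rs → sumP (ps ++ rs) ≃ sumP ps +P sumP rs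
sumP-++ []       rs = ≃-refl
sumP-++ (p ∷ ps) rs = begin
  p +P sumP (ps ++ rs)          ≈⟨ +P-cong ≃-refl (sumP-++ ps rs) ⟩
  p +P (sumP ps +P sumP rs)     ≈⟨ +P-assoc p _ _ ⟨
  (p +P sumP ps) +P sumP rs     ∎
  where open SetoidReasoning ≃-setoid

coeff-*P-∷ : ∀ a p r k → coeff ((a ∷ p) *P r) k ≡ a ℤ.* coeff r k ℤ.+ coeff (ℤ.0ℤ ∷ (p *P r)) k
coeff-*P-∷ a p r k = trans (coeff-+P (scale a r) _ k) (cong (ℤ._+ _) (coeff-scale a r k))

∷-cong : ∀ a {p r} → p ≃ r → (a ∷ p) ≃ (a ∷ r)
∷-cong a p≃r = coeffwise λ where
  zero    → refl
  (suc k) → coeff-≡ p≃r k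


*P-congʳ : ∀ p {r r′} → r ≃ r′ → p *P r ≃ p *P r′
*P-congʳ []      r≃r′ = ≃-refl
*P-congʳ (a ∷ p) {r} {r′} r≃r′ = +P-coeffwise (scale a r) _ (scale a r′) _ λ where
    zero    → cong (ℤ._+ ℤ.0ℤ) (scaled zero)
    (suc k) → cong₂ ℤ._+_ (scaled (suc k)) (coeff-≡ (*P-congʳ p r≃r′) k)
  where
  scaled : ∀ k → coeff (scale a r) k ≡ coeff (scale a r′) k
  scaled k = trans (coeff-scale a r k) (trans (cong (a ℤ.*_) (coeff-≡ r≃r′ k)) (sym (coeff-scale a r′ k)))

private
  interchange : ∀ a b x y → (a ℤ.+ b) ℤ.+ (x ℤ.+ y) ≡ (a ℤ.+ x) ℤ.+ (b ℤ.+ y)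
  interchange = ℤ-Solver.solve-∀

*P-distribʳ-+P : ∀ p p′ r → (p +P p′) *P r ≃ (p *P r) +P (p′ *P r)
*P-distribʳ-+P []      p′       r = ≃-refl
*P-distribʳ-+P (a ∷ p) []       r = ≃-sym (+P-identityʳ _)
*P-distribʳ-+P (a ∷ p) (b ∷ p′) r = coeffwise λ k → begin
  coeff (scale (a ℤ.+ b) r +P (ℤ.0ℤ ∷ ((p +P p′) *P r))) k
    ≡⟨ coeff-+P (scale (a ℤ.+ b) r) _ k ⟩
  coeff (scale (a ℤ.+ b) r) k ℤ.+ coeff (ℤ.0ℤ ∷ ((p +P p′) *P r)) k
    ≡⟨ cong₂ ℤ._+_ (trans (coeff-scale (a ℤ.+ b) r k) (ℤ.*-distribʳ-+ (coeff r k) a b)) (shifted k) ⟩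
  (a ℤ.* coeff r k ℤ.+ b ℤ.* coeff r k) ℤ.+ (coeff (ℤ.0ℤ ∷ p *P r) k ℤ.+ coeff (ℤ.0ℤ ∷ p′ *P r) k)
    ≡⟨ interchange (a ℤ.* coeff r k) _ _ _ ⟩
  (a ℤ.* coeff r k ℤ.+ coeff (ℤ.0ℤ ∷ p *P r) k) ℤ.+ (b ℤ.* coeff r k ℤ.+ coeff (ℤ.0ℤ ∷ p′ *P r) k)
    ≡⟨ cong₂ ℤ._+_ (coeff-*P-∷ a p r k) (coeff-*P-∷ b p′ r k) ⟨
  coeff ((a ∷ p) *P r) k ℤ.+ coeff ((b ∷ p′) *P r) k
    ≡⟨ coeff-+P ((a ∷ p) *P r) _ k ⟨
  coeff (((a ∷ p) *P r) +P ((b ∷ p′) *P r)) k ∎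
  where
  open ≡-Reasoning
  shifted : ∀ k → coeff (ℤ.0ℤ ∷ ((p +P p′) *P r)) k ≡ coeff (ℤ.0ℤ ∷ p *P r) k ℤ.+ coeff (ℤ.0ℤ ∷ p′ *P r) k
  shifted zero    = refl
  shifted (suc k) = trans (coeff-≡ (*P-distribʳ-+P p p′ r) k) (coeff-+P (p *P r) (p′ *P r) k)

*P-zeroʳ : ∀ p → p *P [] ≃ []
*P-zeroʳ []      = ≃-refl
*P-zeroʳ (a ∷ p) = coeffwise λ where
  zero    → refl
  (suc k) → coeff-≡ (*P-zeroʳ p) k

*P-distribˡ-+P : ∀ p r r′ → p *P (r +P r′) ≃ (p *P r) +P (p *P r′)
*P-distribˡ-+P []      r r′ = ≃-refl
*P-distribˡ-+P (a ∷ p) r r′ = coeffwise λ k → begin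
  coeff ((a ∷ p) *P (r +P r′)) k
    ≡⟨ coeff-*P-∷ a p (r +P r′) k ⟩
  a ℤ.* coeff (r +P r′) k ℤ.+ coeff (ℤ.0ℤ ∷ (p *P (r +P r′))) k
    ≡⟨ cong₂ ℤ._+_ (trans (cong (a ℤ.*_) (coeff-+P r r′ k)) (ℤ.*-distribˡ-+ a _ _)) (shifted k) ⟩
  (a ℤ.* coeff r k ℤ.+ a ℤ.* coeff r′ k) ℤ.+ (coeff (ℤ.0ℤ ∷ (p *P r)) k ℤ.+ coeff (ℤ.0ℤ ∷ (p *P r′)) k)
    ≡⟨ interchange (a ℤ.* coeff r k) _ _ _ ⟩
  (a ℤ.* coeff r k ℤ.+ coeff (ℤ.0ℤ ∷ (p *P r)) k) ℤ.+ (a ℤ.* coeff r′ k ℤ.+ coeff (ℤ.0ℤ ∷ (p *P r′)) k)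
    ≡⟨ cong₂ ℤ._+_ (coeff-*P-∷ a p r k) (coeff-*P-∷ a p r′ k) ⟨
  coeff ((a ∷ p) *P r) k ℤ.+ coeff ((a ∷ p) *P r′) k
    ≡⟨ coeff-+P ((a ∷ p) *P r) _ k ⟨
  coeff (((a ∷ p) *P r) +P ((a ∷ p) *P r′)) k ∎
  where
  open ≡-Reasoning
  shifted : ∀ k →
    coeff (ℤ.0ℤ ∷ (p *P (r +P r′))) k ≡ coeff (ℤ.0ℤ ∷ (p *P r)) k ℤ.+ coeff (ℤ.0ℤ ∷ (p *P r′)) k
  shifted zero    = refl
  shifted (suc k) = trans (coeff-≡ (*P-distribˡ-+P p r r′) k) (coeff-+P (p *P r) (p *P r′) k)

scale-mono : ∀ a b e → scale a (mono b e) ≡ mono (a ℤ.* b) e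
scale-mono a b zero    = refl
scale-mono a b (suc e) = cong₂ _∷_ (ℤ.*-zeroʳ a) (scale-mono a b e)

mono-*P-mono : ∀ a b e f → mono a e *P mono b f ≃ mono (a ℤ.* b) (e ℕ.+ f)
mono-*P-mono a b zero    f = coeffwise λ k → begin
  coeff (scale a (mono b f) +P (ℤ.0ℤ ∷ [])) k                ≡⟨ coeff-+P (scale a (mono b f)) (ℤ.0ℤ ∷ []) k ⟩
  coeff (scale a (mono b f)) k ℤ.+ coeff (ℤ.0ℤ ∷ []) k      ≡⟨ cong (ℤ._+_ (coeff (scale a (mono b f)) k)) (coeff-zero k) ⟩
  coeff (scale a (mono b f)) k ℤ.+ ℤ.0ℤ                     ≡⟨ ℤ.+-identityʳ _ ⟩
  coeff (scale a (mono b f)) k                             ≡⟨ cong (λ p → coeff p k) (scale-mono a b f) ⟩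
  coeff (mono (a ℤ.* b) f) k                               ∎
  where
  open ≡-Reasoning
  coeff-zero : ∀ k → coeff (ℤ.0ℤ ∷ []) k ≡ ℤ.0ℤ
  coeff-zero zero    = refl
  coeff-zero (suc k) = refl
mono-*P-mono a b (suc e) f = coeffwise λ k → begin
  coeff (mono a (suc e) *P mono b f) k
    ≡⟨ coeff-*P-∷ (ℤ.0ℤ) (mono a e) (mono b f) k ⟩
  ℤ.0ℤ ℤ.* coeff (mono b f) k ℤ.+ coeff (ℤ.0ℤ ∷ (mono a e *P mono b f)) k
    ≡⟨ ℤ.+-identityˡ _ ⟩
  coeff (ℤ.0ℤ ∷ (mono a e *P mono b f)) k
    ≡⟨ coeff-≡ (∷-cong (ℤ.0ℤ) (mono-*P-mono a b e f)) k ⟩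
  coeff (mono (a ℤ.* b) (suc e ℕ.+ f)) k ∎
  where open ≡-Reasoning

-- Signs and sums of powers of -q

sgn-cong-%2 : ∀ m n → m % 2 ≡ n % 2 → sgn m ≡ sgn n
sgn-cong-%2 _ _ = cong (λ r → if r ≡ᵇ 0 then ℤ.1ℤ else ℤ.-1ℤ)

sgn-suc : ∀ n → sgn (suc n) ≡ - sgn n
sgn-suc zero    = refl
sgn-suc (suc n) = trans (sym (ℤ.neg-involutive (sgn n))) (cong -_ (sym (sgn-suc n)))

sgn-+ : ∀ m n → sgn (m + n) ≡ sgn m ℤ.* sgn n
sgn-+ zero    n = sym (ℤ.*-identityˡ (sgn n))
sgn-+ (suc m) n = begin
  sgn (suc m + n)          ≡⟨ sgn-suc (m + n) ⟩
  - sgn (m + n)            ≡⟨ cong -_ (sgn-+ m n) ⟩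
  - (sgn m ℤ.* sgn n)      ≡⟨ ℤ.neg-distribˡ-* (sgn m) (sgn n) ⟩
  - sgn m ℤ.* sgn n        ≡⟨ cong (ℤ._* sgn n) (sgn-suc m) ⟨
  sgn (suc m) ℤ.* sgn n    ∎
  where open ≡-Reasoning

sgn-even-*-+ : ∀ {c} → 2 ∣ c → ∀ a b → sgn (c * a + b) ≡ sgn b
sgn-even-*-+ (divides q refl) a b = sgn-cong-%2 (q * 2 * a + b) b (begin
  (q * 2 * a + b) % 2    ≡⟨ cong (_% 2) (regroup q a b) ⟩
  (b + q * a * 2) % 2    ≡⟨ [m+kn]%n≡m%n b (q * a) 2 ⟩
  b % 2                  ∎)
  where
  open ≡-Reasoning
  regroup : ∀ q a b → q * 2 * a + b ≡ b + q * a * 2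
  regroup = ℕ-Solver.solve-∀

infixr 6 _⊕_
_⊕_ : List ℕ → List ℕ → List ℕ
es ⊕ fs = concatMap (λ e → map (e +_) fs) es

map-+-⊕ : ∀ e fs gs → map (e +_) fs ⊕ gs ≡ map (e +_) (fs ⊕ gs)
map-+-⊕ e []       gs = refl
map-+-⊕ e (f ∷ fs) gs = begin
  map ((e + f) +_) gs ++ map (e +_) fs ⊕ gs               ≡⟨ cong₂ _++_ (map-cong (ℕ.+-assoc e f) gs) (map-+-⊕ e fs gs) ⟩
  map (λ g → e + (f + g)) gs ++ map (e +_) (fs ⊕ gs)      ≡⟨ cong (_++ _) (map-∘ gs) ⟩
  map (e +_) (map (f +_) gs) ++ map (e +_) (fs ⊕ gs)      ≡⟨ map-++ (e +_) (map (f +_) gs) _ ⟨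
  map (e +_) ((f ∷ fs) ⊕ gs)                              ∎
  where open ≡-Reasoning

⊕-assoc : ∀ es fs gs → (es ⊕ fs) ⊕ gs ≡ es ⊕ (fs ⊕ gs)
⊕-assoc []       fs gs = refl
⊕-assoc (e ∷ es) fs gs = begin
  (map (e +_) fs ++ es ⊕ fs) ⊕ gs              ≡⟨ concatMap-++ (λ e → map (e +_) gs) (map (e +_) fs) _ ⟩
  map (e +_) fs ⊕ gs ++ (es ⊕ fs) ⊕ gs         ≡⟨ cong₂ _++_ (map-+-⊕ e fs gs) (⊕-assoc es fs gs) ⟩
  map (e +_) (fs ⊕ gs) ++ es ⊕ (fs ⊕ gs)       ∎
  where open ≡-Reasoning

⊕-identityˡ : ∀ fs → (0 ∷ []) ⊕ fs ≡ fs
⊕-identityˡ fs = trans (++-identityʳ (map (0 +_) fs)) (map-id fs)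

⊕-identityʳ : ∀ es → es ⊕ (0 ∷ []) ≡ es
⊕-identityʳ []       = refl
⊕-identityʳ (e ∷ es) = cong₂ _∷_ (ℕ.+-identityʳ e) (⊕-identityʳ es)

⨁ : List (List ℕ) → List ℕ
⨁ = foldr _⊕_ (0 ∷ [])

⨁-∷ʳ : ∀ ess fs → ⨁ (ess ∷ʳ fs) ≡ ⨁ ess ⊕ fs
⨁-∷ʳ []         fs = trans (⊕-identityʳ fs) (sym (⊕-identityˡ fs))
⨁-∷ʳ (es ∷ ess) fs = trans (cong (es ⊕_) (⨁-∷ʳ ess fs)) (sym (⊕-assoc es (⨁ ess) fs))

negQPow : ℕ → Poly
negQPow e = mono (sgn e) e

negQPowSum : List ℕ → Poly
negQPowSum es = sumP (map negQPow es)

negQPow-*P : ∀ m n → negQPow m *P negQPow n ≃ negQPow (m + n)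
negQPow-*P m n = ≃-trans (mono-*P-mono (sgn m) (sgn n) m n) (≃-reflexive (cong (λ s → mono s (m + n)) (sym (sgn-+ m n))))

negQPowSum-↭ : ∀ {es fs} → es ↭ fs → negQPowSum es ≃ negQPowSum fs
negQPowSum-↭ es↭fs = sumP-↭ (map⁺ negQPow es↭fs)

negQPowSum-++ : ∀ es fs → negQPowSum (es ++ fs) ≃ negQPowSum es +P negQPowSum fs
negQPowSum-++ es fs = ≃-trans (≃-reflexive (cong sumP (map-++ negQPow es fs))) (sumP-++ (map negQPow es) _)

negQPow-*P-negQPowSum : ∀ e fs → negQPow e *P negQPowSum fs ≃ negQPowSum (map (e +_) fs)
negQPow-*P-negQPowSum e []       = *P-zeroʳ (negQPow e)
negQPow-*P-negQPowSum e (f ∷ fs) = begin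
  negQPow e *P (negQPow f +P negQPowSum fs)                 ≈⟨ *P-distribˡ-+P (negQPow e) _ _ ⟩
  (negQPow e *P negQPow f) +P (negQPow e *P negQPowSum fs)  ≈⟨ +P-cong (negQPow-*P e f) (negQPow-*P-negQPowSum e fs) ⟩
  negQPow (e + f) +P negQPowSum (map (e +_) fs)             ∎
  where open SetoidReasoning ≃-setoid

negQPowSum-*P : ∀ es fs → negQPowSum es *P negQPowSum fs ≃ negQPowSum (es ⊕ fs)
negQPowSum-*P []       fs = ≃-refl
negQPowSum-*P (e ∷ es) fs = begin
  (negQPow e +P negQPowSum es) *P negQPowSum fs                    ≈⟨ *P-distribʳ-+P (negQPow e) _ _ ⟩
  (negQPow e *P negQPowSum fs) +P (negQPowSum es *P negQPowSum fs)  ≈⟨ +P-cong (negQPow-*P-negQPowSum e fs) (negQPowSum-*P es fs) ⟩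
  negQPowSum (map (e +_) fs) +P negQPowSum (es ⊕ fs)                ≈⟨ negQPowSum-++ (map (e +_) fs) _ ⟨
  negQPowSum ((e ∷ es) ⊕ fs)                                        ∎
  where open SetoidReasoning ≃-setoid

prodP-negQPowSum : ∀ ess → prodP (map negQPowSum ess) ≃ negQPowSum (⨁ ess)
prodP-negQPowSum []         = ≃-refl
prodP-negQPowSum (es ∷ ess) = begin
  negQPowSum es *P prodP (map negQPowSum ess)  ≈⟨ *P-congʳ (negQPowSum es) (prodP-negQPowSum ess) ⟩
  negQPowSum es *P negQPowSum (⨁ ess)          ≈⟨ negQPowSum-*P es (⨁ ess) ⟩
  negQPowSum (es ⊕ ⨁ ess)                      ∎
  where open SetoidReasoning ≃-setoid

-- The insertion lemma for maj

interval : ℕ → ℕ → List ℕ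
interval s k = iterate suc s k

interval-∷ʳ : ∀ s k → interval s (suc k) ≡ interval s k ∷ʳ (s + k)
interval-∷ʳ s zero    = cong (_∷ []) (sym (ℕ.+-identityʳ s))
interval-∷ʳ s (suc k) = cong (s ∷_) (trans (interval-∷ʳ (suc s) k) (cong (interval (suc s) k ∷ʳ_) (sym (ℕ.+-suc s k))))

map-+-interval : ∀ d s k → map (_+ d) (interval s k) ≡ interval (s + d) k
map-+-interval d s zero    = refl
map-+-interval d s (suc k) = cong (s + d ∷_) (map-+-interval d (suc s) k)

map-+-upTo : ∀ s k → map (s +_) (upTo k) ≡ interval s k
map-+-upTo s k = trans (map-upTo (s +_) k) (applyUpTo≡interval s k (s +_) (λ _ → refl))
  where
  applyUpTo≡interval : ∀ s k (f : ℕ → ℕ) → (∀ i → f i ≡ s + i) → applyUpTo f k ≡ interval s k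
  applyUpTo≡interval s zero    f f≗s+ = refl
  applyUpTo≡interval s (suc k) f f≗s+ = cong₂ _∷_ (trans (f≗s+ 0) (ℕ.+-identityʳ s))
    (applyUpTo≡interval (suc s) k (λ i → f (suc i)) (λ i → trans (f≗s+ (suc i)) (ℕ.+-suc s i)))


↭-interval-drop-last : ∀ {X} s k → X ∷ʳ (s + k) ↭ interval s (suc k) → X ↭ interval s k
↭-interval-drop-last {X} s k p =
  drop-∷ (↭-trans (∷↭∷ʳ (s + k) X) (↭-trans p (↭-trans (↭-reflexive (interval-∷ʳ s k)) (↭-sym (∷↭∷ʳ (s + k) _)))))

↭-interval-drop-first : ∀ {X} s k → X ∷ʳ s ↭ interval s (suc k) → X ↭ interval (suc s) k
↭-interval-drop-first {X} s k p = drop-∷ (↭-trans (∷↭∷ʳ s X) p)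

↭-interval-shift : ∀ {X} d s k → X ↭ interval s k → map (_+ d) X ↭ interval (s + d) k
↭-interval-shift d s k p = ↭-trans (map⁺ (_+ d) p) (↭-reflexive (map-+-interval d s k))

∷ʳ-swap : ∀ (X : List ℕ) u v → X ∷ʳ u ∷ʳ v ↭ X ∷ʳ v ∷ʳ u
∷ʳ-swap X u v = begin
  X ∷ʳ u ∷ʳ v     ≡⟨ ++-assoc X (u ∷ []) (v ∷ []) ⟩
  X ++ u ∷ v ∷ [] ↭⟨ ++⁺ˡ X (swap u v ↭-refl) ⟩
  X ++ v ∷ u ∷ [] ≡⟨ ++-assoc X (v ∷ []) (u ∷ []) ⟨
  X ∷ʳ v ∷ʳ u     ∎
  where open PermutationReasoning

↭-interval-add-ends : ∀ {X} s k → X ↭ interval (suc s) k → X ∷ʳ s ∷ʳ (suc s + k) ↭ interval s (suc (suc k))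
↭-interval-add-ends {X} s k p = begin
  X ∷ʳ s ∷ʳ (suc s + k)             ≡⟨ ++-assoc X (s ∷ []) _ ⟩
  X ++ s ∷ (suc s + k) ∷ []         ↭⟨ shift s X _ ⟩
  s ∷ X ∷ʳ (suc s + k)              ↭⟨ prep s (++⁺ʳ _ p) ⟩
  s ∷ interval (suc s) k ∷ʳ (suc s + k) ≡⟨ cong (s ∷_) (interval-∷ʳ (suc s) k) ⟨
  interval s (suc (suc k))          ∎
  where open PermutationReasoning

↭-interval-add-last2 : ∀ {X} s k → X ↭ interval s k → X ∷ʳ (s + k) ∷ʳ (s + suc k) ↭ interval s (suc (suc k))
↭-interval-add-last2 {X} s k p = begin
  X ∷ʳ (s + k) ∷ʳ (s + suc k)                  ↭⟨ ++⁺ʳ _ (++⁺ʳ _ p) ⟩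
  interval s k ∷ʳ (s + k) ∷ʳ (s + suc k)       ≡⟨ cong (_∷ʳ (s + suc k)) (interval-∷ʳ s k) ⟨
  interval s (suc k) ∷ʳ (s + suc k)            ≡⟨ interval-∷ʳ s (suc k) ⟨
  interval s (suc (suc k))                     ∎
  where open PermutationReasoning

↭-interval-add-first2 : ∀ {X} s k → X ↭ interval (suc (suc s)) k → X ∷ʳ suc s ∷ʳ s ↭ interval s (suc (suc k))
↭-interval-add-first2 {X} s k p = begin
  X ∷ʳ suc s ∷ʳ s    ↭⟨ ∷↭∷ʳ s _ ⟨
  s ∷ X ∷ʳ suc s     ↭⟨ prep s (∷↭∷ʳ (suc s) X) ⟨
  s ∷ suc s ∷ X      ↭⟨ prep s (prep (suc s) p) ⟩
  interval s (suc (suc k)) ∎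
  where open PermutationReasoning

infixl 7 _·[_]
_·[_] : ℕ → Bool → ℕ
n ·[ b ] = if b then n else 0

private
  ∷ʳ∷ʳ-cong : ∀ {X Y : List ℕ} {u u′ v v′} → u′ ≡ u → v′ ≡ v → X ∷ʳ u ∷ʳ v ↭ Y → X ∷ʳ u′ ∷ʳ v′ ↭ Y
  ∷ʳ∷ʳ-cong refl refl p = p

  ∷ʳ-cong : ∀ {X Y : List ℕ} {u u′} → u′ ≡ u → X ∷ʳ u′ ↭ Y → X ∷ʳ u ↭ Y
  ∷ʳ-cong refl p = p

  interval-start-cong : ∀ {X s s′} k → s ≡ s′ → X ↭ interval s k → X ↭ interval s′ k
  interval-start-cong k refl p = p

-- Inserting x into w a b is computed from inserting x
-- into w a, whose maj values are A and the value M + m·[a > x] of the insertion at the end.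
-- The booleans ab, ax and xb are the comparisons a > b, a > x and x > b, and m is the length of w a.
insertion-step-descent : ∀ (A : List ℕ) M m (ax xb : Bool) → (¬ T xb → T ax) →
  A ∷ʳ (M + m ·[ ax ]) ↭ interval M (suc m) →
  map (_+ suc m) A ∷ʳ (M + m ·[ ax ] + suc m ·[ xb ]) ∷ʳ (M + m + suc m ·[ not xb ])
    ↭ interval (M + m) (suc (suc m))
insertion-step-descent A M m true  xb _ p = ends xb
  where
  shifted : map (_+ suc m) A ↭ interval (suc (M + m)) m
  shifted = interval-start-cong m (ℕ.+-suc M m) (↭-interval-shift (suc m) M m (↭-interval-drop-last M m p))
  ends : ∀ xb → map (_+ suc m) A ∷ʳ (M + m + suc m ·[ xb ]) ∷ʳ (M + m + suc m ·[ not xb ]) ↭ interval (M + m) (suc (suc m))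
  ends true  = ↭-trans (∷ʳ-swap _ _ _)
    (∷ʳ∷ʳ-cong (ℕ.+-identityʳ (M + m)) (ℕ.+-suc (M + m) m) (↭-interval-add-ends (M + m) m shifted))
  ends false = ∷ʳ∷ʳ-cong (ℕ.+-identityʳ (M + m)) (ℕ.+-suc (M + m) m) (↭-interval-add-ends (M + m) m shifted)
insertion-step-descent A M m false true  _ p =
  ∷ʳ∷ʳ-cong (trans (cong (_+ suc m) (ℕ.+-identityʳ M)) (ℕ.+-suc M m)) (ℕ.+-identityʳ (M + m))
    (↭-interval-add-first2 (M + m) m (interval-start-cong m (cong suc (ℕ.+-suc M m))
      (↭-interval-shift (suc m) (suc M) m (↭-interval-drop-first M m (∷ʳ-cong (ℕ.+-identityʳ M) p)))))
insertion-step-descent A M m false false x≯b⇒a>x p = ⊥-elim (x≯b⇒a>x (λ ()))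

insertion-step-ascent : ∀ (A : List ℕ) M m (ax xb : Bool) → (T ax → ¬ T xb) →
  A ∷ʳ (M + m ·[ ax ]) ↭ interval M (suc m) →
  map (_+ 0) A ∷ʳ (M + m ·[ ax ] + suc m ·[ xb ]) ∷ʳ (M + 0 + suc m ·[ not xb ])
    ↭ interval (M + 0) (suc (suc m))
insertion-step-ascent A M m true  true  a>x⇒x≯b p = ⊥-elim (a>x⇒x≯b _ _)
insertion-step-ascent A M m true  false _ p =
  ∷ʳ∷ʳ-cong (trans (ℕ.+-identityʳ (M + m)) (cong (_+ m) (sym (ℕ.+-identityʳ M)))) refl
    (↭-interval-add-last2 (M + 0) m (↭-interval-shift 0 M m (↭-interval-drop-last M m p)))
insertion-step-ascent A M m false xb    _ p = ends xb
  where
  shifted : map (_+ 0) A ↭ interval (suc (M + 0)) m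
  shifted = ↭-interval-shift 0 (suc M) m (↭-interval-drop-first M m (∷ʳ-cong (ℕ.+-identityʳ M) p))
  ends : ∀ xb → map (_+ 0) A ∷ʳ (M + 0 + suc m ·[ xb ]) ∷ʳ (M + 0 + suc m ·[ not xb ]) ↭ interval (M + 0) (suc (suc m))
  ends true  = ↭-trans (∷ʳ-swap _ _ _)
    (∷ʳ∷ʳ-cong (ℕ.+-identityʳ (M + 0)) (ℕ.+-suc (M + 0) m) (↭-interval-add-ends (M + 0) m shifted))
  ends false = ∷ʳ∷ʳ-cong (ℕ.+-identityʳ (M + 0)) (ℕ.+-suc (M + 0) m) (↭-interval-add-ends (M + 0) m shifted)

insertion-step : ∀ (A : List ℕ) M m (ab ax xb : Bool) →
  (T ab → ¬ T xb → T ax) → (¬ T ab → T ax → ¬ T xb) →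
  A ∷ʳ (M + m ·[ ax ]) ↭ interval M (suc m) →
  map (_+ suc m ·[ ab ]) A ∷ʳ (M + m ·[ ax ] + suc m ·[ xb ]) ∷ʳ (M + m ·[ ab ] + suc m ·[ not xb ])
    ↭ interval (M + m ·[ ab ]) (suc (suc m))
insertion-step A M m true  ax xb a>b⇒ _ = insertion-step-descent A M m ax xb (a>b⇒ _)
insertion-step A M m false ax xb _ a≯b⇒ = insertion-step-ascent A M m ax xb (a≯b⇒ (λ ()))

module _ (c : ℕ) where

  private
    module Lex = StrictTotalOrder (×-strictTotalOrder ℕ.<-strictTotalOrder ℕ.<-strictTotalOrder)

    key : Letter → ℕ × ℕ
    key (a , s) = rank c s , a

    gtL⇒key< : ∀ x y → T (gtL c x y) → key y Lex.< key x
    gtL⇒key< (a , s) (b , t) x>y = Sum.map (ℕ.<ᵇ⇒< _ _) sameRank (Equivalence.to T-∨ x>y)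
      where
      sameRank : T ((rank c s ≡ᵇ rank c t) ∧ (b <ᵇ a)) → rank c t ≡ rank c s × b < a
      sameRank h with eq , lt ← Equivalence.to T-∧ h = sym (ℕ.≡ᵇ⇒≡ _ _ eq) , ℕ.<ᵇ⇒< _ _ lt

    key<⇒gtL : ∀ x y → key y Lex.< key x → T (gtL c x y)
    key<⇒gtL (a , s) (b , t) y<x = Equivalence.from T-∨ (Sum.map ℕ.<⇒<ᵇ sameRank y<x)
      where
      sameRank : rank c t ≡ rank c s × b < a → T ((rank c s ≡ᵇ rank c t) ∧ (b <ᵇ a))
      sameRank (eq , lt) = Equivalence.from T-∧ (ℕ.≡⇒≡ᵇ _ _ (sym eq) , ℕ.<⇒<ᵇ lt)

  gtL-trans : ∀ x y z → T (gtL c x y) → T (gtL c y z) → T (gtL c x z)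
  gtL-trans x y z x>y y>z = key<⇒gtL x z (Lex.trans (gtL⇒key< y z y>z) (gtL⇒key< x y x>y))

  gtL-asym : ∀ x y → T (gtL c x y) → ¬ T (gtL c y x)
  gtL-asym x y x>y y>x = Lex.asym (gtL⇒key< x y x>y) (gtL⇒key< y x y>x)

  gtL-connex : ∀ x y → proj₁ x ≢ proj₁ y → ¬ T (gtL c x y) → T (gtL c y x)
  gtL-connex x y x≢y x≯y with Lex.compare (key x) (key y)
  ... | tri< x<y _ _ = key<⇒gtL y x x<y
  ... | tri≈ _ x≈y _ = ⊥-elim (x≢y (proj₂ x≈y))
  ... | tri> _ _ y<x = ⊥-elim (x≯y (key<⇒gtL x y y<x))

  gtL-flip : ∀ x y → proj₁ x ≢ proj₁ y → gtL c y x ≡ not (gtL c x y)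
  gtL-flip x y x≢y = ¬-not distinct
    where
    distinct : gtL c y x ≢ gtL c x y
    distinct eq with gtL c x y in x>y
    ... | true  = gtL-asym x y (subst T (sym x>y) _) (subst T (sym eq) _)
    ... | false = subst T eq (gtL-connex x y x≢y (subst T x>y))

  headDescent : ℕ → Letter → List Letter → ℕ
  headDescent i y []      = 0
  headDescent i y (z ∷ _) = i ·[ gtL c y z ]

  majFrom-∷ : ∀ i y w → majFrom c i (y ∷ w) ≡ headDescent i y w + majFrom c (suc i) w
  majFrom-∷ i y []      = refl
  majFrom-∷ i y (z ∷ w) = refl

  headDescent-∷ʳ : ∀ i y w a b → headDescent i y (w ∷ʳ a ∷ʳ b) ≡ headDescent i y (w ∷ʳ a)
  headDescent-∷ʳ i y []      a b = refl
  headDescent-∷ʳ i y (z ∷ w) a b = refl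

  majFrom-∷ʳ : ∀ i w a b → majFrom c i (w ∷ʳ a ∷ʳ b) ≡ majFrom c i (w ∷ʳ a) + (i + length w) ·[ gtL c a b ]
  majFrom-∷ʳ i []      a b with gtL c a b
  ... | true  = refl
  ... | false = refl
  majFrom-∷ʳ i (y ∷ w) a b = begin
    majFrom c i (y ∷ w ∷ʳ a ∷ʳ b)
      ≡⟨ majFrom-∷ i y (w ∷ʳ a ∷ʳ b) ⟩
    headDescent i y (w ∷ʳ a ∷ʳ b) + majFrom c (suc i) (w ∷ʳ a ∷ʳ b)
      ≡⟨ cong₂ _+_ (headDescent-∷ʳ i y w a b) (majFrom-∷ʳ (suc i) w a b) ⟩
    headDescent i y (w ∷ʳ a) + (majFrom c (suc i) (w ∷ʳ a) + (suc i + length w) ·[ gtL c a b ])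
      ≡⟨ ℕ.+-assoc (headDescent i y (w ∷ʳ a)) _ _ ⟨
    headDescent i y (w ∷ʳ a) + majFrom c (suc i) (w ∷ʳ a) + (suc i + length w) ·[ gtL c a b ]
      ≡⟨ cong₂ _+_ (majFrom-∷ i y (w ∷ʳ a)) (cong (_·[ gtL c a b ]) (ℕ.+-suc i (length w))) ⟨
    majFrom c i (y ∷ w ∷ʳ a) + (i + length (y ∷ w)) ·[ gtL c a b ] ∎
    where open ≡-Reasoning

  map-maj-insertions-∷ʳ : ∀ x w b →
    map (maj c) (insertions x (w ∷ʳ b)) ≡ map (λ ι → maj c (ι ∷ʳ b)) (insertions x w) ∷ʳ maj c (w ∷ʳ b ∷ʳ x)
  map-maj-insertions-∷ʳ x w b = begin
    map (maj c) (insertions x (w ∷ʳ b))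
      ≡⟨ cong (map (maj c)) (insertions-∷ʳ x w b) ⟩
    map (maj c) (map (_∷ʳ b) (insertions x w) ∷ʳ (w ∷ʳ b ∷ʳ x))
      ≡⟨ map-++ (maj c) (map (_∷ʳ b) (insertions x w)) _ ⟩
    map (maj c) (map (_∷ʳ b) (insertions x w)) ∷ʳ maj c (w ∷ʳ b ∷ʳ x)
      ≡⟨ cong (_∷ʳ maj c (w ∷ʳ b ∷ʳ x)) (map-∘ (insertions x w)) ⟨
    map (λ ι → maj c (ι ∷ʳ b)) (insertions x w) ∷ʳ maj c (w ∷ʳ b ∷ʳ x) ∎
    where open ≡-Reasoning

  module InsertionStep (x : Letter) (p : List Letter) (a b : Letter) where
    L : ℕ
    L = length p

    M : ℕ
    M = maj c (p ∷ʳ a)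

    front : List ℕ
    front = map (λ κ → maj c (κ ∷ʳ a)) (insertions x p)

    maj-insertions-before : map (maj c) (insertions x (p ∷ʳ a)) ≡ front ∷ʳ (M + suc L ·[ gtL c a x ])
    maj-insertions-before = trans (map-maj-insertions-∷ʳ x p a) (cong (front ∷ʳ_) (majFrom-∷ʳ 1 p a x))

    maj-insertions-after : proj₁ x ≢ proj₁ b →
      map (maj c) (insertions x (p ∷ʳ a ∷ʳ b)) ≡
        map (_+ suc (suc L) ·[ gtL c a b ]) front
          ∷ʳ (M + suc L ·[ gtL c a x ] + suc (suc L) ·[ gtL c x b ])
          ∷ʳ (M + suc L ·[ gtL c a b ] + suc (suc L) ·[ not (gtL c x b) ])
    maj-insertions-after x≢b = begin
      map (maj c) (insertions x (p ∷ʳ a ∷ʳ b))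
        ≡⟨ map-maj-insertions-∷ʳ x (p ∷ʳ a) b ⟩
      map (λ ι → maj c (ι ∷ʳ b)) (insertions x (p ∷ʳ a)) ∷ʳ maj c (p ∷ʳ a ∷ʳ b ∷ʳ x)
        ≡⟨ cong (λ ιs → map (λ ι → maj c (ι ∷ʳ b)) ιs ∷ʳ maj c (p ∷ʳ a ∷ʳ b ∷ʳ x)) (insertions-∷ʳ x p a) ⟩
      map (λ ι → maj c (ι ∷ʳ b)) (map (_∷ʳ a) (insertions x p) ∷ʳ (p ∷ʳ a ∷ʳ x)) ∷ʳ maj c (p ∷ʳ a ∷ʳ b ∷ʳ x)
        ≡⟨ cong (_∷ʳ maj c (p ∷ʳ a ∷ʳ b ∷ʳ x)) (map-++ (λ ι → maj c (ι ∷ʳ b)) (map (_∷ʳ a) (insertions x p)) _) ⟩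
      map (λ ι → maj c (ι ∷ʳ b)) (map (_∷ʳ a) (insertions x p))
        ∷ʳ maj c (p ∷ʳ a ∷ʳ x ∷ʳ b) ∷ʳ maj c (p ∷ʳ a ∷ʳ b ∷ʳ x)
        ≡⟨ cong₂ _∷ʳ_ (cong₂ _∷ʳ_ shiftedFront insertedLastButOne) insertedLast ⟩
      map (_+ suc (suc L) ·[ gtL c a b ]) front
        ∷ʳ (M + suc L ·[ gtL c a x ] + suc (suc L) ·[ gtL c x b ])
        ∷ʳ (M + suc L ·[ gtL c a b ] + suc (suc L) ·[ not (gtL c x b) ]) ∎
      where
      open ≡-Reasoning
      appendB : ∀ {κ} → κ ↭ x ∷ p → maj c (κ ∷ʳ a ∷ʳ b) ≡ maj c (κ ∷ʳ a) + suc (suc L) ·[ gtL c a b ]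
      appendB {κ} κ↭ = trans (majFrom-∷ʳ 1 κ a b) (cong (λ n → maj c (κ ∷ʳ a) + suc n ·[ gtL c a b ]) (↭-length κ↭))
      shiftedFront : map (λ ι → maj c (ι ∷ʳ b)) (map (_∷ʳ a) (insertions x p)) ≡ map (_+ suc (suc L) ·[ gtL c a b ]) front
      shiftedFront = trans (sym (map-∘ (insertions x p)))
        (trans (map-cong-local (All.map appendB (insertions-↭ x p))) (map-∘ (insertions x p)))
      insertedLastButOne : maj c (p ∷ʳ a ∷ʳ x ∷ʳ b) ≡ M + suc L ·[ gtL c a x ] + suc (suc L) ·[ gtL c x b ]
      insertedLastButOne = trans (majFrom-∷ʳ 1 (p ∷ʳ a) x b)
        (cong₂ (λ m n → m + suc n ·[ gtL c x b ]) (majFrom-∷ʳ 1 p a x) (length-∷ʳ p a))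
      insertedLast : maj c (p ∷ʳ a ∷ʳ b ∷ʳ x) ≡ M + suc L ·[ gtL c a b ] + suc (suc L) ·[ not (gtL c x b) ]
      insertedLast = trans (majFrom-∷ʳ 1 (p ∷ʳ a) b x)
        (cong₂ _+_ (majFrom-∷ʳ 1 p a b) (cong₂ (λ n g → suc n ·[ g ]) (length-∷ʳ p a) (gtL-flip x b x≢b)))

  maj-insertions-∷ʳ∷ʳ : ∀ x p a b → All (λ y → proj₁ y ≢ proj₁ x) (p ∷ʳ a ∷ʳ b) →
    map (maj c) (insertions x (p ∷ʳ a)) ↭ interval (maj c (p ∷ʳ a)) (suc (length (p ∷ʳ a))) →
    map (maj c) (insertions x (p ∷ʳ a ∷ʳ b)) ↭ interval (maj c (p ∷ʳ a ∷ʳ b)) (suc (length (p ∷ʳ a ∷ʳ b)))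
  maj-insertions-∷ʳ∷ʳ x p a b p∷ʳa∷ʳb≢x IH = begin
    map (maj c) (insertions x (p ∷ʳ a ∷ʳ b))
      ≡⟨ maj-insertions-after x≢b ⟩
    map (_+ suc (suc L) ·[ gtL c a b ]) front
      ∷ʳ (M + suc L ·[ gtL c a x ] + suc (suc L) ·[ gtL c x b ])
      ∷ʳ (M + suc L ·[ gtL c a b ] + suc (suc L) ·[ not (gtL c x b) ])
      ↭⟨ insertion-step front M (suc L) (gtL c a b) (gtL c a x) (gtL c x b) a>b⇒x≯b⇒a>x a≯b⇒a>x⇒x≯b IH′ ⟩
    interval (M + suc L ·[ gtL c a b ]) (suc (suc (suc L)))
      ≡⟨ cong₂ interval (majFrom-∷ʳ 1 p a b) (cong suc (trans (length-∷ʳ (p ∷ʳ a) b) (cong suc (length-∷ʳ p a)))) ⟨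
    interval (maj c (p ∷ʳ a ∷ʳ b)) (suc (length (p ∷ʳ a ∷ʳ b))) ∎
    where
    open PermutationReasoning
    open InsertionStep x p a b
    x≢b : proj₁ x ≢ proj₁ b
    x≢b = All.head (All.++⁻ʳ (p ∷ʳ a) p∷ʳa∷ʳb≢x) ∘ sym
    IH′ : front ∷ʳ (M + suc L ·[ gtL c a x ]) ↭ interval M (suc (suc L))
    IH′ = subst₂ _↭_ maj-insertions-before (cong (λ n → interval M (suc n)) (length-∷ʳ p a)) IH
    a>b⇒x≯b⇒a>x : T (gtL c a b) → ¬ T (gtL c x b) → T (gtL c a x)
    a>b⇒x≯b⇒a>x a>b x≯b = gtL-trans a b x a>b (gtL-connex x b x≢b x≯b)
    a≯b⇒a>x⇒x≯b : ¬ T (gtL c a b) → T (gtL c a x) → ¬ T (gtL c x b)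
    a≯b⇒a>x⇒x≯b a≯b a>x x>b = a≯b (gtL-trans a x b a>x x>b)

  maj-insertions-interval : ∀ x {u} → Reverse u → All (λ y → proj₁ y ≢ proj₁ x) u →
    map (maj c) (insertions x u) ↭ interval (maj c u) (suc (length u))
  maj-insertions-interval x [] _ = ↭-refl
  maj-insertions-interval x (_ ∶ [] ∶ʳ b) (b≢x ∷ []) rewrite gtL-flip x b (b≢x ∘ sym) with gtL c x b
  ... | true  = swap 1 0 ↭-refl
  ... | false = ↭-refl
  maj-insertions-interval x (_ ∶ rw@(p ∶ _ ∶ʳ a) ∶ʳ b) u≢x =
    maj-insertions-∷ʳ∷ʳ x p a b u≢x (maj-insertions-interval x rw (All.++⁻ˡ (p ∷ʳ a) u≢x))

  maj-insertions : ∀ x u → All (λ y → proj₁ y ≢ proj₁ x) u →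
    map (maj c) (insertions x u) ↭ map (maj c u +_) (upTo (suc (length u)))
  maj-insertions x u u≢x = ↭-trans (maj-insertions-interval x (reverseView u) u≢x) (↭-reflexive (sym (map-+-upTo (maj c u) _)))

-- The insertion lemma for inv

private
  below : ℕ → List ℕ → ℕ
  below a ι = length (filterᵇ (_<ᵇ a) ι)

inv-insertions : ∀ v σ → All (_< v) σ → map inv (insertions v σ) ≡ map (inv σ +_) (downFrom (suc (length σ)))
inv-insertions v []      []          = refl
inv-insertions v (a ∷ σ) (a<v ∷ σ<v) = cong₂ _∷_ first rest
  where
  first : inv (v ∷ a ∷ σ) ≡ inv (a ∷ σ) + suc (length σ)
  first = trans (cong (λ l → length l + inv (a ∷ σ)) (filter-all (T? ∘ (_<ᵇ v)) (All.map ℕ.<⇒<ᵇ (a<v ∷ σ<v))))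
                (ℕ.+-comm (suc (length σ)) (inv (a ∷ σ)))
  v≮a : ¬ T (v <ᵇ a)
  v≮a v<a = ℕ.<⇒≯ a<v (ℕ.<ᵇ⇒< v a v<a)
  rest : map inv (map (a ∷_) (insertions v σ)) ≡ map (inv (a ∷ σ) +_) (downFrom (suc (length σ)))
  rest = begin
    map inv (map (a ∷_) (insertions v σ))
      ≡⟨ map-∘ (insertions v σ) ⟨
    map (λ ι → below a ι + inv ι) (insertions v σ)
      ≡⟨ map-cong-local (All.map (λ eq → cong (λ l → length l + _) eq) (filterᵇ-insertions (_<ᵇ a) v≮a σ)) ⟩
    map (λ ι → below a σ + inv ι) (insertions v σ)
      ≡⟨ map-∘ (insertions v σ) ⟩
    map (below a σ +_) (map inv (insertions v σ))
      ≡⟨ cong (map (below a σ +_)) (inv-insertions v σ σ<v) ⟩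
    map (below a σ +_) (map (inv σ +_) (downFrom (suc (length σ))))
      ≡⟨ map-∘ (downFrom (suc (length σ))) ⟨
    map (λ d → below a σ + (inv σ + d)) (downFrom (suc (length σ)))
      ≡⟨ map-cong (λ d → ℕ.+-assoc (below a σ) (inv σ) d) (downFrom (suc (length σ))) ⟨
    map (inv (a ∷ σ) +_) (downFrom (suc (length σ))) ∎
    where open ≡-Reasoning

invAbs-insertions : ∀ v t π → All (λ y → proj₁ y < v) π →
  map (inv ∘ abs) (insertions (v , t) π) ↭ map (inv (abs π) +_) (upTo (suc (length π)))
invAbs-insertions v t π π<v = begin
  map (inv ∘ abs) (insertions (v , t) π)                    ≡⟨ map-∘ (insertions (v , t) π) ⟩
  map inv (map abs (insertions (v , t) π))                  ≡⟨ cong (map inv) (map-insertions proj₁ (v , t) π) ⟩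
  map inv (insertions v (abs π))                            ≡⟨ inv-insertions v (abs π) (All.map⁺ π<v) ⟩
  map (inv (abs π) +_) (downFrom (suc (length (abs π))))    ≡⟨ cong (λ n → map (inv (abs π) +_) (downFrom (suc n))) (length-map proj₁ π) ⟩
  map (inv (abs π) +_) (downFrom (suc (length π)))          ≡⟨ cong (map (inv (abs π) +_)) (reverse-upTo (suc (length π))) ⟨
  map (inv (abs π) +_) (reverse (upTo (suc (length π))))    ↭⟨ map⁺ (inv (abs π) +_) (↭-reverse (upTo (suc (length π)))) ⟩
  map (inv (abs π) +_) (upTo (suc (length π)))              ∎
  where open PermutationReasoning

col-insertions : ∀ x π → All (λ ι → col ι ≡ col π + proj₂ x) (insertions x π)
col-insertions x π =
  All.map (λ ι↭x∷π → trans (sum-↭ (map⁺ proj₂ ι↭x∷π)) (ℕ.+-comm (proj₂ x) (col π))) (insertions-↭ x π)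

-- Coloured permutations

perms-↭ : ∀ n → All (_↭ applyUpTo suc n) (perms n)
perms-↭ zero    = ↭-refl ∷ []
perms-↭ (suc n) =
  All-concatMap⁺ (All.map (λ σ↭ → All.map (λ ι↭ → step ι↭ σ↭) (insertions-↭ (suc n) _)) (perms-↭ n))
  where
  step : ∀ {ι σ} → ι ↭ suc n ∷ σ → σ ↭ applyUpTo suc n → ι ↭ applyUpTo suc (suc n)
  step {ι} {σ} ι↭ σ↭ = begin
    ι                            ↭⟨ ι↭ ⟩
    suc n ∷ σ                    ↭⟨ prep (suc n) σ↭ ⟩
    suc n ∷ applyUpTo suc n      ↭⟨ ∷↭∷ʳ (suc n) _ ⟩
    applyUpTo suc n ∷ʳ suc n     ≡⟨ applyUpTo-∷ʳ suc n ⟩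
    applyUpTo suc (suc n)        ∎
    where open PermutationReasoning

module _ (c : ℕ) where

  colours : List ℕ
  colours = upTo c

  factorExponents : ℕ → List ℕ
  factorExponents i = upTo (c * suc i)

  coloured-insertions : ∀ (s : List Letter → ℕ) v π k →
    (∀ t → map s (insertions (v , t) π) ↭ map (s π +_) (upTo k)) →
    map (λ ι → c * s ι + col ι) (concatMap (λ t → insertions (v , t) π) colours)
      ↭ map ((c * s π + col π) +_) (upTo (c * k))
  coloured-insertions s v π k s-insertions = begin
    map stat (concatMap (λ t → insertions (v , t) π) colours)
      ≡⟨ map-concatMap stat (λ t → insertions (v , t) π) colours ⟩
    concatMap (λ t → map stat (insertions (v , t) π)) colours
      ↭⟨ concatMap-cong-↭ colours (All.tabulate (λ {t} _ → oneColour t)) ⟩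
    concatMap (λ t → map (λ d → S + (c * d + t)) (upTo k)) colours
      ↭⟨ concatMap-map-comm (λ t d → S + (c * d + t)) colours (upTo k) ⟩
    concatMap (λ d → map (λ t → S + (c * d + t)) colours) (upTo k)
      ≡⟨ concatMap-cong (λ d → map-∘ colours) (upTo k) ⟩
    concatMap (λ d → map (S +_) (map (c * d +_) colours)) (upTo k)
      ≡⟨ map-concatMap (S +_) (λ d → map (c * d +_) colours) (upTo k) ⟨
    map (S +_) (concatMap (λ d → map (c * d +_) colours) (upTo k))
      ≡⟨ cong (map (S +_)) (upTo-* c k) ⟩
    map (S +_) (upTo (c * k)) ∎
    where
    open PermutationReasoning
    stat : List Letter → ℕ
    stat ι = c * s ι + col ι
    S : ℕ
    S = stat π
    regroup : ∀ c s p d t → c * (s + d) + (p + t) ≡ c * s + p + (c * d + t)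
    regroup = ℕ-Solver.solve-∀
    oneColour : ∀ t → map stat (insertions (v , t) π) ↭ map (λ d → S + (c * d + t)) (upTo k)
    oneColour t = begin
      map stat (insertions (v , t) π)
        ≡⟨ map-cong-local (All.map (λ {ι} → cong (c * s ι +_)) (col-insertions (v , t) π)) ⟩
      map (λ ι → c * s ι + (col π + t)) (insertions (v , t) π)
        ≡⟨ map-∘ (insertions (v , t) π) ⟩
      map (λ m → c * m + (col π + t)) (map s (insertions (v , t) π))
        ↭⟨ map⁺ (λ m → c * m + (col π + t)) (s-insertions t) ⟩
      map (λ m → c * m + (col π + t)) (map (s π +_) (upTo k))
        ≡⟨ map-∘ (upTo k) ⟨
      map (λ d → c * (s π + d) + (col π + t)) (upTo k)
        ≡⟨ map-cong (λ d → regroup c (s π) (col π) d t) (upTo k) ⟩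
      map (λ d → S + (c * d + t)) (upTo k) ∎

  consAllColours : ℕ → List (List Letter) → List (List Letter)
  consAllColours a πs = concatMap (λ t → map ((a , t) ∷_) πs) colours

  colourings : List ℕ → List (List Letter)
  colourings []      = [] ∷ []
  colourings (a ∷ σ) = consAllColours a (colourings σ)

  insertAllColours : ℕ → List Letter → List (List Letter)
  insertAllColours v π = concatMap (λ t → insertions (v , t) π) colours

  zipL-colorWords : ∀ σ → map (zipL σ) (colorWords c (length σ)) ≡ colourings σ
  zipL-colorWords []      = refl
  zipL-colorWords (a ∷ σ) = begin
    map (zipL (a ∷ σ)) (concatMap (λ t → map (t ∷_) (colorWords c (length σ))) colours)
      ≡⟨ map-concatMap (zipL (a ∷ σ)) _ colours ⟩
    concatMap (λ t → map (zipL (a ∷ σ)) (map (t ∷_) (colorWords c (length σ)))) colours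
      ≡⟨ concatMap-cong (λ t → trans (sym (map-∘ W)) (trans (map-∘ W) (cong (map ((a , t) ∷_)) (zipL-colorWords σ)))) colours ⟩
    consAllColours a (colourings σ) ∎
    where
    open ≡-Reasoning
    W : List (List ℕ)
    W = colorWords c (length σ)

  consAllColours-↭ : ∀ a {πs πs′} → πs ↭ πs′ → consAllColours a πs ↭ consAllColours a πs′
  consAllColours-↭ a πs↭πs′ = concatMap-cong-↭ colours (All.tabulate λ {t} _ → map⁺ ((a , t) ∷_) πs↭πs′)

  concatMap-consAllColours : ∀ a (f : A → List (List Letter)) xs →
    concatMap (consAllColours a ∘ f) xs ↭ consAllColours a (concatMap f xs)
  concatMap-consAllColours a f xs = begin
    concatMap (λ x → concatMap (λ t → map ((a , t) ∷_) (f x)) colours) xs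
      ↭⟨ concatMap-comm (λ x t → map ((a , t) ∷_) (f x)) xs colours ⟩
    concatMap (λ t → concatMap (λ x → map ((a , t) ∷_) (f x)) xs) colours
      ≡⟨ concatMap-cong (λ t → map-concatMap ((a , t) ∷_) f xs) colours ⟨
    consAllColours a (concatMap f xs) ∎
    where open PermutationReasoning

  insertAllColours-∷ : ∀ v y ρ →
    insertAllColours v (y ∷ ρ) ↭ map (λ t → (v , t) ∷ y ∷ ρ) colours ++ map (y ∷_) (insertAllColours v ρ)
  insertAllColours-∷ v y ρ = begin
    concatMap (λ t → ((v , t) ∷ y ∷ ρ) ∷ map (y ∷_) (insertions (v , t) ρ)) colours
      ↭⟨ concatMap-++-↭ (λ t → ((v , t) ∷ y ∷ ρ) ∷ []) (λ t → map (y ∷_) (insertions (v , t) ρ)) colours ⟩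
    concatMap (λ t → ((v , t) ∷ y ∷ ρ) ∷ []) colours ++ concatMap (λ t → map (y ∷_) (insertions (v , t) ρ)) colours
      ≡⟨ cong₂ _++_ (concatMap-[-] (λ t → (v , t) ∷ y ∷ ρ) colours) (sym (map-concatMap (y ∷_) (λ t → insertions (v , t) ρ) colours)) ⟩
    map (λ t → (v , t) ∷ y ∷ ρ) colours ++ map (y ∷_) (insertAllColours v ρ) ∎
    where open PermutationReasoning

  consAllColours-swap : ∀ v a πs →
    concatMap (λ u → concatMap (λ ρ → map (λ t → (v , t) ∷ (a , u) ∷ ρ) colours) πs) colours
      ↭ consAllColours v (consAllColours a πs)
  consAllColours-swap v a πs = begin
    concatMap (λ u → concatMap (λ ρ → map (λ t → (v , t) ∷ (a , u) ∷ ρ) colours) πs) colours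
      ↭⟨ concatMap-cong-↭ colours (All.tabulate λ {u} _ → concatMap-map-comm (λ ρ t → (v , t) ∷ (a , u) ∷ ρ) πs colours) ⟩
    concatMap (λ u → concatMap (λ t → map (λ ρ → (v , t) ∷ (a , u) ∷ ρ) πs) colours) colours
      ↭⟨ concatMap-comm (λ u t → map (λ ρ → (v , t) ∷ (a , u) ∷ ρ) πs) colours colours ⟩
    concatMap (λ t → concatMap (λ u → map (λ ρ → (v , t) ∷ (a , u) ∷ ρ) πs) colours) colours
      ≡⟨ concatMap-cong (λ t → trans (concatMap-cong (λ u → map-∘ πs) colours) (sym (map-concatMap ((v , t) ∷_) _ colours))) colours ⟩
    consAllColours v (consAllColours a πs) ∎
    where open PermutationReasoning

  concatMap-insertAllColours-consAllColours : ∀ v a πs →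
    concatMap (insertAllColours v) (consAllColours a πs)
      ↭ consAllColours v (consAllColours a πs) ++ consAllColours a (concatMap (insertAllColours v) πs)
  concatMap-insertAllColours-consAllColours v a πs = begin
    concatMap I (consAllColours a πs)
      ≡⟨ concatMap-concatMap I _ colours ⟩
    concatMap (λ u → concatMap I (map ((a , u) ∷_) πs)) colours
      ≡⟨ concatMap-cong (λ u → concatMap-map I ((a , u) ∷_) πs) colours ⟩
    concatMap (λ u → concatMap (λ ρ → I ((a , u) ∷ ρ)) πs) colours
      ↭⟨ concatMap-cong-↭ colours (All.tabulate λ {u} _ → concatMap-cong-↭ πs (All.tabulate λ {ρ} _ → insertAllColours-∷ v (a , u) ρ)) ⟩
    concatMap (λ u → concatMap (λ ρ → new u ρ ++ map ((a , u) ∷_) (I ρ)) πs) colours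
      ↭⟨ concatMap-cong-↭ colours (All.tabulate λ {u} _ → concatMap-++-↭ (new u) (λ ρ → map ((a , u) ∷_) (I ρ)) πs) ⟩
    concatMap (λ u → concatMap (new u) πs ++ concatMap (λ ρ → map ((a , u) ∷_) (I ρ)) πs) colours
      ↭⟨ concatMap-++-↭ (λ u → concatMap (new u) πs) (λ u → concatMap (λ ρ → map ((a , u) ∷_) (I ρ)) πs) colours ⟩
    concatMap (λ u → concatMap (new u) πs) colours ++ concatMap (λ u → concatMap (λ ρ → map ((a , u) ∷_) (I ρ)) πs) colours
      ↭⟨ ++⁺ (consAllColours-swap v a πs) (↭-reflexive (concatMap-cong (λ u → sym (map-concatMap ((a , u) ∷_) I πs)) colours)) ⟩
    consAllColours v (consAllColours a πs) ++ consAllColours a (concatMap I πs) ∎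
    where
    open PermutationReasoning
    I : List Letter → List (List Letter)
    I = insertAllColours v
    new : ℕ → List Letter → List (List Letter)
    new u ρ = map (λ t → (v , t) ∷ (a , u) ∷ ρ) colours

  concatMap-colourings-insertions : ∀ v σ →
    concatMap colourings (insertions v σ) ↭ concatMap (insertAllColours v) (colourings σ)
  concatMap-colourings-insertions v []      = ↭-refl
  concatMap-colourings-insertions v (a ∷ σ) = begin
    consAllColours v (consAllColours a (colourings σ)) ++ concatMap colourings (map (a ∷_) (insertions v σ))
      ≡⟨ cong (consAllColours v (consAllColours a (colourings σ)) ++_) (concatMap-map colourings (a ∷_) (insertions v σ)) ⟩
    consAllColours v (consAllColours a (colourings σ)) ++ concatMap (consAllColours a ∘ colourings) (insertions v σ)
      ↭⟨ ++⁺ˡ _ (concatMap-consAllColours a colourings (insertions v σ)) ⟩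
    consAllColours v (consAllColours a (colourings σ)) ++ consAllColours a (concatMap colourings (insertions v σ))
      ↭⟨ ++⁺ˡ _ (consAllColours-↭ a (concatMap-colourings-insertions v σ)) ⟩
    consAllColours v (consAllColours a (colourings σ)) ++ consAllColours a (concatMap (insertAllColours v) (colourings σ))
      ↭⟨ concatMap-insertAllColours-consAllColours v a (colourings σ) ⟨
    concatMap (insertAllColours v) (colourings (a ∷ σ)) ∎
    where open PermutationReasoning

  colourings-abs : ∀ σ → All (λ π → abs π ≡ σ) (colourings σ)
  colourings-abs []      = refl ∷ []
  colourings-abs (a ∷ σ) = All-concatMap⁺ {xs = upTo c}
    (All.tabulate λ {t} _ → All.map⁺ {f = (a , t) ∷_} (All.map (cong (a ∷_)) (colourings-abs σ)))

  G≡concatMap-colourings : ∀ n → G c n ≡ concatMap colourings (perms n)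
  G≡concatMap-colourings n = cong concat (map-cong-local (All.map zipL-colorWords′ (perms-↭ n)))
    where
    zipL-colorWords′ : ∀ {σ} → σ ↭ applyUpTo suc n → map (zipL σ) (colorWords c n) ≡ colourings σ
    zipL-colorWords′ {σ} σ↭ = trans (cong (λ m → map (zipL σ) (colorWords c m)) (sym (trans (↭-length σ↭) (length-applyUpTo suc n))))
                                    (zipL-colorWords σ)

  G-abs-↭ : ∀ n → All (λ π → abs π ↭ applyUpTo suc n) (G c n)
  G-abs-↭ n rewrite G≡concatMap-colourings n =
    All-concatMap⁺ (All.map (λ σ↭ → All.map (λ abs≡σ → ↭-trans (↭-reflexive abs≡σ) σ↭) (colourings-abs _)) (perms-↭ n))

  G-suc : ∀ n → G c (suc n) ↭ concatMap (insertAllColours (suc n)) (G c n)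
  G-suc n = begin
    G c (suc n)
      ≡⟨ G≡concatMap-colourings (suc n) ⟩
    concatMap colourings (concatMap (insertions (suc n)) (perms n))
      ≡⟨ concatMap-concatMap colourings (insertions (suc n)) (perms n) ⟩
    concatMap (λ σ → concatMap colourings (insertions (suc n) σ)) (perms n)
      ↭⟨ concatMap-cong-↭ (perms n) (All.tabulate λ {σ} _ → concatMap-colourings-insertions (suc n) σ) ⟩
    concatMap (λ σ → concatMap (insertAllColours (suc n)) (colourings σ)) (perms n)
      ≡⟨ concatMap-concatMap (insertAllColours (suc n)) colourings (perms n) ⟨
    concatMap (insertAllColours (suc n)) (concatMap colourings (perms n))
      ≡⟨ cong (concatMap (insertAllColours (suc n))) (G≡concatMap-colourings n) ⟨
    concatMap (insertAllColours (suc n)) (G c n) ∎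
    where open PermutationReasoning

  -- The exponent multiset of ∏_{i=1}^n [c i]_{-q}: all sums e₁ + … + eₙ with eᵢ < c i.
  staircase : ℕ → List ℕ
  staircase n = ⨁ (map factorExponents (upTo n))

  staircase-suc : ∀ n → staircase (suc n) ≡ staircase n ⊕ upTo (c * suc n)
  staircase-suc n = begin
    ⨁ (map factorExponents (upTo (suc n)))                  ≡⟨ cong (⨁ ∘ map factorExponents) (upTo-∷ʳ n) ⟨
    ⨁ (map factorExponents (upTo n ∷ʳ n))                   ≡⟨ cong ⨁ (map-++ factorExponents (upTo n) (n ∷ [])) ⟩
    ⨁ (map factorExponents (upTo n) ∷ʳ factorExponents n)   ≡⟨ ⨁-∷ʳ (map factorExponents (upTo n)) (factorExponents n) ⟩
    staircase n ⊕ factorExponents n                         ∎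
    where open ≡-Reasoning

  distribution : ∀ (s : List Letter → ℕ) → s [] ≡ 0 →
    (∀ v t π → All (λ y → proj₁ y < v) π → map s (insertions (v , t) π) ↭ map (s π +_) (upTo (suc (length π)))) →
    ∀ n → map (λ π → c * s π + col π) (G c n) ↭ staircase n
  distribution s s[]≡0 s-insertions zero    =
    ↭-reflexive (cong (_∷ []) (trans (ℕ.+-identityʳ _) (trans (cong (c *_) s[]≡0) (ℕ.*-zeroʳ c))))
  distribution s s[]≡0 s-insertions (suc n) = begin
    map stat (G c (suc n))
      ↭⟨ map⁺ stat (G-suc n) ⟩
    map stat (concatMap (insertAllColours (suc n)) (G c n))
      ≡⟨ map-concatMap stat (insertAllColours (suc n)) (G c n) ⟩
    concatMap (map stat ∘ insertAllColours (suc n)) (G c n)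
      ↭⟨ concatMap-cong-↭ (G c n) (All.map colouredInsertions (G-abs-↭ n)) ⟩
    concatMap (λ π → map (stat π +_) (upTo (c * suc n))) (G c n)
      ≡⟨ concatMap-map (λ e → map (e +_) (upTo (c * suc n))) stat (G c n) ⟨
    map stat (G c n) ⊕ upTo (c * suc n)
      ↭⟨ concatMap-↭ (λ e → map (e +_) (upTo (c * suc n))) (distribution s s[]≡0 s-insertions n) ⟩
    staircase n ⊕ upTo (c * suc n)
      ≡⟨ staircase-suc n ⟨
    staircase (suc n) ∎
    where
    open PermutationReasoning
    stat : List Letter → ℕ
    stat π = c * s π + col π
    colouredInsertions : ∀ {π} → abs π ↭ applyUpTo suc n →
      map stat (insertAllColours (suc n) π) ↭ map (stat π +_) (upTo (c * suc n))
    colouredInsertions {π} abs↭ = coloured-insertions s (suc n) π (suc n) λ t →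
      subst (λ k → map s (insertions (suc n , t) π) ↭ map (s π +_) (upTo (suc k))) lengthπ (s-insertions (suc n) t π π<suc-n)
      where
      lengthπ : length π ≡ n
      lengthπ = trans (sym (length-map proj₁ π)) (trans (↭-length abs↭) (length-applyUpTo suc n))
      π<suc-n : All (λ y → proj₁ y < suc n) π
      π<suc-n = All.map⁻ (All-resp-↭ (↭-sym abs↭) (All.applyUpTo⁺₁ suc n s<s))

fmaj-distribution : ∀ c n → map (fmaj c) (G c n) ↭ staircase c n
fmaj-distribution c = distribution c (maj c) refl λ v t π π<v → maj-insertions c (v , t) π (All.map ℕ.<⇒≢ π<v)

invT-distribution : ∀ c n → map (invT c) (G c n) ↭ staircase c n
invT-distribution c = distribution c (inv ∘ abs) refl invAbs-insertions

signedSum≡negQPowSum : ∀ c n f g → (∀ π → sgn (f π) ≡ sgn (g π)) → signedSum c n f g ≡ negQPowSum (map g (G c n))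
signedSum≡negQPowSum c n f g sgnf≡sgng =
  cong sumP (trans (map-cong (λ π → cong (λ s → mono s (g π)) (sgnf≡sgng π)) (G c n)) (map-∘ (G c n)))

sgn-invT≡sgn-fmaj : ∀ {c} → 2 ∣ c → ∀ π → sgn (invT c π) ≡ sgn (fmaj c π)
sgn-invT≡sgn-fmaj {c} 2∣c π = trans (sgn-even-*-+ 2∣c (inv (abs π)) (col π)) (sym (sgn-even-*-+ 2∣c (maj c π) (col π)))

rhsProd≃negQPowSum : ∀ c n → rhsProd c n ≃ negQPowSum (staircase c n)
rhsProd≃negQPowSum c n = ≃-trans
  (≃-reflexive (cong prodP (map-∘ {g = negQPowSum} {f = factorExponents c} (upTo n))))
  (prodP-negQPowSum (map (factorExponents c) (upTo n)))

corollary2p3 : (c n : ℕ) → 0 < c → 2 ∣ c → 1 ≤ n →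
    (signedSum c n (invT c) (fmaj c) ≈P signedSum c n (fmaj c) (invT c))
    × (signedSum c n (fmaj c) (invT c) ≈P rhsProd c n)
corollary2p3 c n _ 2∣c _ =
  coeff-≡ (≃-trans fmajSum (≃-sym invTSum)) , coeff-≡ (≃-trans invTSum (≃-sym (rhsProd≃negQPowSum c n)))
  where
  fmajSum : signedSum c n (invT c) (fmaj c) ≃ negQPowSum (staircase c n)
  fmajSum = ≃-trans (≃-reflexive (signedSum≡negQPowSum c n (invT c) (fmaj c) (sgn-invT≡sgn-fmaj 2∣c)))
                    (negQPowSum-↭ (fmaj-distribution c n))
  invTSum : signedSum c n (fmaj c) (invT c) ≃ negQPowSum (staircase c n)
  invTSum = ≃-trans (≃-reflexive (signedSum≡negQPowSum c n (fmaj c) (invT c) (sym ∘ sgn-invT≡sgn-fmaj 2∣c)))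
                    (negQPowSum-↭ (invT-distribution c n))
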